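{- Let $G$ be a connected bipartite $k$-regular graph with $2r$ vertices. If $r=2m$ is even, then $h_G\le\frac12$. If $r=2m+1$ is odd, then $h_G\le\frac12+\frac{1}{8(m+\frac12)^2}=\frac12+\frac{1}{2r^2}$.
   Context: For $A,B\subseteq V(G)$, $E[A,B]$ is the number of ordered pairs $(x,y)$ with $x\in A$, $y\in B$, $x\sim y$; $\mathrm{vol}(S)=\sum_{x\in S}\deg(x)$; $S^c=V(G)\setminus S$. The Cheeger constant is $h_G=\min\{E[S,S^c]/\mathrm{vol}(S):\emptyset\ne S\subseteq V(G),\ |S|\le|V(G)|/2\}$. -}

module Defs where

open import Data.Bool using (Bool; true; false; if_then_else_; _∧_)
open import Data.Nat as ℕ using (ℕ; zero; suc; _≤_; _≤ᵇ_)
open import Data.Fin using (Fin)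
open import Data.Fin.Subset using (Subset; ∁; ∣_∣)
open import Data.Vec as Vec using (Vec; []; _∷_; lookup; tabulate)
open import Data.List as List using (List; []; _∷_; _++_)
open import Data.Maybe using (Maybe; just; nothing)
open import Data.Integer using (+_)
open import Data.Rational using (ℚ; _/_; _⊓_)
open import Data.Product using (Σ; _×_)
open import Relation.Binary.PropositionalEquality using (_≡_; _≢_)
open import Relation.Binary.Construct.Closure.ReflexiveTransitive using (Star)

record Graph (n : ℕ) : Set where
  field
    adj   : Fin n → Fin n → Bool
    sym   : ∀ x y → adj x y ≡ adj y x
    irrefl : ∀ x → adj x x ≡ false
open Graph public

_∼[_]_ : ∀ {n} → Fin n → Graph n → Fin n → Set
x ∼[ G ] y = adj G x y ≡ true

Σᵥ : ∀ {n} → (Fin n → ℕ) → ℕ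
Σᵥ f = Vec.sum (tabulate f)

[_] : Bool → ℕ
[ true ] = 1
[ false ] = 0

deg : ∀ {n} → Graph n → Fin n → ℕ
deg G x = Σᵥ (λ y → [ adj G x y ])

E[_,_]_ : ∀ {n} → Subset n → Subset n → Graph n → ℕ
E[ A , B ] G = Σᵥ (λ x → Σᵥ (λ y → [ lookup A x ∧ (lookup B y ∧ adj G x y) ]))

vol : ∀ {n} → Graph n → Subset n → ℕ
vol G S = Σᵥ (λ x → if lookup S x then deg G x else 0)

Connected : ∀ {n} → Graph n → Set
Connected {n} G = ∀ (x y : Fin n) → Star (λ u v → u ∼[ G ] v) x y

Bipartite : ∀ {n} → Graph n → Set
Bipartite {n} G = Σ (Fin n → Bool) λ c → ∀ x y → x ∼[ G ] y → c x ≢ c y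

Regular : ∀ {n} → ℕ → Graph n → Set
Regular k G = ∀ x → deg G x ≡ k

allSubsets : ∀ n → List (Subset n)
allSubsets zero = [] ∷ []
allSubsets (suc n) = List.map (true ∷_) (allSubsets n) ++ List.map (false ∷_) (allSubsets n)

-- minimum of a list of (possibly undefined) rationals: nothing if the list is
-- empty or contains an undefined entry
minimum : List (Maybe ℚ) → Maybe ℚ
minimum [] = nothing
minimum (nothing ∷ qs) = nothing
minimum (just q ∷ qs) with qs | minimum qs
... | [] | _ = just q
... | _ ∷ _ | nothing = nothing
... | _ ∷ _ | just p  = just (q ⊓ p)

-- the ratios E[S,S^c]/vol(S) for the admissible S (nonempty, |S| ≤ |V|/2,
-- i.e. 2|S| ≤ |V|); the ratio is undefined (nothing) when vol(S) = 0
ratios : ∀ {n} → Graph n → List (Subset n) → List (Maybe ℚ)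
ratios G [] = []
ratios {n} G (S ∷ Ss) with ∣ S ∣ | 2 ℕ.* ∣ S ∣ ≤ᵇ n | vol G S
... | zero  | _     | _     = ratios G Ss
... | suc _ | false | _     = ratios G Ss
... | suc _ | true  | zero  = nothing ∷ ratios G Ss
... | suc _ | true  | suc v = just ((+ (E[ S , ∁ S ] G)) / suc v) ∷ ratios G Ss

-- Cheeger constant h_G = min { E[S,S^c]/vol(S) : ∅ ≠ S ⊆ V, |S| ≤ |V|/2 }.
-- It is nothing (undefined) if there is no admissible S or some admissible S
-- has vol(S) = 0.
cheeger : ∀ {n} → Graph n → Maybe ℚ
cheeger {n} G = minimum (ratios G (allSubsets n))

module Submission where

-- Let G be connected, bipartite with colour classes A and B, k-regular, on
-- 2r vertices; double counting edges gives |A| = |B| = r.  For P ⊆ A,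
-- T ⊆ B the only edges inside P ∪ T run between P and T, so
--   cut(P ∪ T) + 2 e(P,T) = k (|P| + |T|).
-- Take |P| = ⌊r/2⌋ = m, a set E ⊆ B and Q ⊆ B ∖ E with |Q| = m, and put
-- T₁ = Q ∪ E, T₂ = B ∖ Q.  Since T₁, T₂ cover B once and E twice,
--   cut(P ∪ T₁) + cut(P ∪ T₂) + 2 e(P,E) = k |B| + k |E|,
-- and both sets have r vertices when |B| = 2m + |E|.  The smaller cut S
-- bounds h_G ≤ cut(S) / (k r).  For r = 2m choose E = ∅: 2 cut(S) ≤ k r,
-- so h_G ≤ ½.  For r = 2m + 1 choose E = {b₀} with b₀ ∈ B having the most
-- neighbours in P, so r e(P,E) ≥ k m by averaging; this gives
-- r · 2 cut(S) ≤ k (r² + 1), i.e. h_G ≤ ½ + 1/(2r²).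

open import Defs hiding (sym)
open import Data.Bool using (Bool; true; false; not; _∧_; _∨_; if_then_else_)
open import Data.Bool.Properties using (∧-identityʳ; T-≡)
open import Data.Nat as ℕ using (ℕ; zero; suc; _*_; _+_; _≤_; _<_; z≤n; s≤s; s≤s⁻¹; _≤?_; _≤ᵇ_; NonZero)
open import Data.Nat.Properties
open import Data.Nat.Tactic.RingSolver using (solve-∀)
open import Data.Fin using (Fin; zero; suc)
import Data.Fin.Properties as Fin
open import Data.Fin.Subset using (Subset; ∁; ∣_∣)
open import Data.Vec as Vec using (_∷_; tabulate; lookup)
open import Data.Vec.Properties using (lookup∘tabulate; lookup-map)
import Data.Vec.Functional as Vector
open import Data.Product using (Σ; _×_; _,_)
open import Data.Sum using (_⊎_; inj₁; inj₂)
open import Data.Empty using (⊥; ⊥-elim)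
open import Data.Maybe using (Maybe; just; nothing)
open import Data.List as List using ([]; _∷_)
open import Data.List.Relation.Unary.All as All using (All; []; _∷_)
open import Data.List.Relation.Unary.Any using (here; there)
open import Data.List.Membership.Propositional using (_∈_)
open import Data.List.Membership.Propositional.Properties using (∈-map⁺; ∈-++⁺ˡ; ∈-++⁺ʳ)
import Data.Integer as ℤ
import Data.Integer.Properties as ℤ
open import Data.Rational using (ℚ; ½; _/_; _⊓_; toℚᵘ) renaming (_≤_ to _≤ℚ_; _+_ to _+ℚ_)
import Data.Rational.Properties as ℚ
open import Data.Rational.Unnormalised using (mkℚᵘ) renaming (_≃_ to _≃ᵘ_)
import Data.Rational.Unnormalised as ℚᵘ
import Data.Rational.Unnormalised.Properties as ℚᵘ
open import Function using (_∘_)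
open import Function.Bundles using (Equivalence)
open import Relation.Nullary using (yes; no)
open import Relation.Nullary.Decidable using (does)
open import Relation.Binary.PropositionalEquality hiding ([_])
open import Relation.Binary.Construct.Closure.ReflexiveTransitive using (_◅_)
open import Algebra.Properties.Semiring.Sum +-*-semiring
  using (sum; sum-syntax; sum-cong-≗; sum-replicate-zero; ∑-distrib-+; ∑-comm; *-distribˡ-sum; *-distribʳ-sum)

-- Finite sums.  Defs writes sums as Σᵥ over a Vec; we work with the
-- library's ∑ over functions, whose algebra is already developed.

Σᵥ≡∑ : ∀ {n} (f : Fin n → ℕ) → Σᵥ f ≡ sum f
Σᵥ≡∑ {zero} f = refl
Σᵥ≡∑ {suc n} f = cong (f zero +_) (Σᵥ≡∑ (f ∘ suc))

∑-zero : ∀ {n} {f : Fin n → ℕ} → (∀ i → f i ≡ 0) → sum f ≡ 0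
∑-zero {n} f≗0 = trans (sum-cong-≗ f≗0) (sum-replicate-zero n)

∑-one : ∀ n → ∑[ i < n ] 1 ≡ n
∑-one zero = refl
∑-one (suc n) = cong suc (∑-one n)

∑-mono : ∀ {n} {f g : Fin n → ℕ} → (∀ i → f i ≤ g i) → sum f ≤ sum g
∑-mono {zero} f≤g = z≤n
∑-mono {suc n} f≤g = +-mono-≤ (f≤g zero) (∑-mono (f≤g ∘ suc))

∑-term : ∀ {n} (f : Fin n → ℕ) i → f i ≤ sum f
∑-term f zero = m≤m+n (f zero) _
∑-term f (suc i) = ≤-trans (∑-term (f ∘ suc) i) (m≤n+m _ (f zero))

∑-δ : ∀ {n} (b : Fin n) (f : Fin n → ℕ) → ∑[ y < n ] ([ does (y Fin.≟ b) ] * f y) ≡ f b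
∑-δ {suc n} zero f = begin
  f zero + 0 + ∑[ y < n ] (0 * f (suc y)) ≡⟨ cong (f zero + 0 +_) (∑-zero {n} (λ _ → refl)) ⟩
  f zero + 0 + 0                          ≡⟨ +-identityʳ _ ⟩
  f zero + 0                              ≡⟨ +-identityʳ _ ⟩
  f zero                                  ∎
  where open ≡-Reasoning
∑-δ {suc n} (suc b) f = ∑-δ b (f ∘ suc)

true≢false : true ≢ false
true≢false ()

[∧] : ∀ a b → [ a ∧ b ] ≡ [ a ] * [ b ]
[∧] true b = sym (+-identityʳ [ b ])
[∧] false b = refl

[not]+[] : ∀ a → [ not a ] + [ a ] ≡ 1
[not]+[] true = refl
[not]+[] false = refl

smaller-of-two : ∀ {A : Set} (f : A → ℕ) {P : A → Set} {a b} → P a → P b →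
  Σ A λ s → P s × 2 * f s ≤ f a + f b
smaller-of-two f {a = a} {b} Pa Pb with f a ≤? f b
... | yes fa≤fb = a , Pa , ≤-trans (≤-reflexive (cong (f a +_) (+-identityʳ (f a)))) (+-monoʳ-≤ (f a) fa≤fb)
... | no  fa≰fb = b , Pb , ≤-trans (≤-reflexive (cong (f b +_) (+-identityʳ (f b)))) (+-monoˡ-≤ (f b) (≰⇒≥ fa≰fb))

odd-bound : ∀ m k x d → 2 * x + 2 * d ≤ k * suc (2 * m) + k * 1 → k * m ≤ suc (2 * m) * d →
  suc (2 * m) * (2 * x) ≤ k * (suc (2 * m) * suc (2 * m) + 1)
odd-bound m k x d cuts≤ km≤Rd = +-cancelʳ-≤ (2 * (k * m)) _ _ (begin
  R * (2 * x) + 2 * (k * m)        ≤⟨ +-monoʳ-≤ (R * (2 * x)) (*-monoʳ-≤ 2 km≤Rd) ⟩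
  R * (2 * x) + 2 * (R * d)        ≡⟨ regroup₁ R x d ⟩
  R * (2 * x + 2 * d)              ≤⟨ *-monoʳ-≤ R cuts≤ ⟩
  R * (k * R + k * 1)              ≡⟨ regroup₂ m k ⟩
  k * (R * R + 1) + 2 * (k * m)    ∎)
  where
  open ≤-Reasoning
  R : ℕ
  R = suc (2 * m)
  regroup₁ : ∀ R x d → R * (2 * x) + 2 * (R * d) ≡ R * (2 * x + 2 * d)
  regroup₁ = solve-∀
  regroup₂ : ∀ m k → suc (2 * m) * (k * suc (2 * m) + k * 1) ≡ k * (suc (2 * m) * suc (2 * m) + 1) + 2 * (k * m)
  regroup₂ = solve-∀

-- R · 2x ≤ k (R² + 1)  gives  x · 2N ≤ (N + 2) · kR  for N = 2R², the
-- cross-multiplied form of  x/(kR) ≤ ½ + 1/N.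
odd-scale : ∀ R k x → R * (2 * x) ≤ k * (R * R + 1) → x * (2 * (2 * R * R)) ≤ (2 * R * R + 2) * (k * R)
odd-scale R k x R2x≤ = begin
  x * (2 * (2 * R * R))        ≡⟨ regroup₁ R x ⟩
  (2 * R) * (R * (2 * x))      ≤⟨ *-monoʳ-≤ (2 * R) R2x≤ ⟩
  (2 * R) * (k * (R * R + 1))  ≡⟨ regroup₂ R k ⟩
  (2 * R * R + 2) * (k * R)    ∎
  where
  open ≤-Reasoning
  regroup₁ : ∀ R x → x * (2 * (2 * R * R)) ≡ (2 * R) * (R * (2 * x))
  regroup₁ = solve-∀
  regroup₂ : ∀ R k → (2 * R) * (k * (R * R + 1)) ≡ (2 * R * R + 2) * (k * R)
  regroup₂ = solve-∀

VSet : ℕ → Set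
VSet n = Fin n → Bool

⌜_⌝ : ∀ {n} → VSet n → Fin n → ℕ
⌜ X ⌝ x = [ X x ]

count : ∀ {n} → VSet n → ℕ
count X = sum ⌜ X ⌝

∣∣≡count : ∀ {n} (S : Subset n) → ∣ S ∣ ≡ count (lookup S)
∣∣≡count Vec.[] = refl
∣∣≡count (true ∷ S) = cong suc (∣∣≡count S)
∣∣≡count (false ∷ S) = ∣∣≡count S

module _ {n : ℕ} where

  infix 4 _⊆_
  infixr 6 _∪_
  infixl 7 _∖_

  _⊆_ : VSet n → VSet n → Set
  X ⊆ Y = ∀ x → X x ≡ true → Y x ≡ true

  Disjoint : VSet n → VSet n → Set
  Disjoint X Y = ∀ x → X x ≡ true → Y x ≡ true → ⊥

  _ᶜ : VSet n → VSet n
  (X ᶜ) x = not (X x)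

  _∪_ _∖_ : VSet n → VSet n → VSet n
  (X ∪ Y) x = X x ∨ Y x
  (X ∖ Y) x = X x ∧ not (Y x)

  ∅ : VSet n
  ∅ _ = false

  ⁅_⁆ : Fin n → VSet n
  ⁅ b ⁆ y = does (y Fin.≟ b)

  ∖⊆ : ∀ {X Y} → X ∖ Y ⊆ X
  ∖⊆ {X} x X∖Yx with X x
  ... | true = refl

  ∪⊆ : ∀ {X Y Z} → X ⊆ Z → Y ⊆ Z → X ∪ Y ⊆ Z
  ∪⊆ {X} X⊆ Y⊆ x X∪Yx with X x in Xx
  ... | true  = X⊆ x Xx
  ... | false = Y⊆ x X∪Yx

  ⁅⁆⊆ : ∀ {b X} → X b ≡ true → ⁅ b ⁆ ⊆ X
  ⁅⁆⊆ {b} Xb y y=b with y Fin.≟ b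
  ... | yes refl = Xb

  ∖-disjoint : ∀ {X Y} → Disjoint (X ∖ Y) Y
  ∖-disjoint {X} {Y} x X∖Yx Yx with X x | Y x | X∖Yx | Yx
  ... | true | true | () | _

  ⌜∪⌝ : ∀ {X Y} → Disjoint X Y → ∀ x → ⌜ X ∪ Y ⌝ x ≡ ⌜ X ⌝ x + ⌜ Y ⌝ x
  ⌜∪⌝ {X} {Y} disj x with X x in Xx | Y x in Yx
  ... | true  | true  = ⊥-elim (disj x Xx Yx)
  ... | true  | false = refl
  ... | false | _     = refl

  count-∪ : ∀ {X Y} → Disjoint X Y → count (X ∪ Y) ≡ count X + count Y
  count-∪ {X} {Y} disj = trans (sum-cong-≗ (⌜∪⌝ disj)) (∑-distrib-+ ⌜ X ⌝ ⌜ Y ⌝)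

  ⌜∖⌝ : ∀ {X Y} → Y ⊆ X → ∀ x → ⌜ X ∖ Y ⌝ x + ⌜ Y ⌝ x ≡ ⌜ X ⌝ x
  ⌜∖⌝ {X} {Y} Y⊆X x with Y x in Yx
  ... | true  rewrite Y⊆X x Yx = refl
  ... | false = trans (+-identityʳ _) (cong [_] (∧-identityʳ (X x)))

  count-∖ : ∀ {X Y} → Y ⊆ X → count (X ∖ Y) + count Y ≡ count X
  count-∖ {X} {Y} Y⊆X = trans (sym (∑-distrib-+ ⌜ X ∖ Y ⌝ ⌜ Y ⌝)) (sum-cong-≗ (⌜∖⌝ Y⊆X))

  count-∅ : count ∅ ≡ 0
  count-∅ = ∑-zero {n} λ _ → refl

  count-⁅⁆ : ∀ b → count ⁅ b ⁆ ≡ 1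
  count-⁅⁆ b = trans (sum-cong-≗ (λ y → sym (*-identityʳ (⌜ ⁅ b ⁆ ⌝ y)))) (∑-δ b (λ _ → 1))

  ⌜cover⌝ : ∀ {B E Q} → Q ⊆ B ∖ E → ∀ y → ⌜ Q ∪ E ⌝ y + ⌜ B ∖ Q ⌝ y ≡ ⌜ B ⌝ y + ⌜ E ⌝ y
  ⌜cover⌝ {B} {E} {Q} Q⊆ y with Q y | Q⊆ y
  ... | false | _ = trans (cong ([ E y ] +_) (cong [_] (∧-identityʳ (B y)))) (+-comm [ E y ] [ B y ])
  ... | true  | Q⊆′ with B y | E y | Q⊆′ refl
  ...   | true | false | _ = refl

select : ∀ {n} (X : VSet n) j → j ≤ count X → Σ (VSet n) λ Y → Y ⊆ X × count Y ≡ j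
select {n} X zero _ = ∅ , (λ _ ()) , count-∅ {n}
select {suc n} X (suc j) j<∣X∣ with X zero in X₀
... | true with select (X ∘ suc) j (s≤s⁻¹ j<∣X∣)
...   | Y , Y⊆X , ∣Y∣ = (true Vector.∷ Y) , (λ { zero _ → X₀ ; (suc x) → Y⊆X x }) , cong suc ∣Y∣
select {suc n} X (suc j) j<∣X∣ | false with select (X ∘ suc) (suc j) j<∣X∣
...   | Y , Y⊆X , ∣Y∣ = (false Vector.∷ Y) , (λ { zero () ; (suc x) → Y⊆X x }) , ∣Y∣

heaviest : ∀ {n} (B : VSet n) (F : Fin n → ℕ) →
  (∀ x → B x ≡ false) ⊎ Σ (Fin n) λ b → B b ≡ true × (∀ x → B x ≡ true → F x ≤ F b)
heaviest {zero} B F = inj₁ λ ()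
heaviest {suc n} B F with heaviest (B ∘ suc) (F ∘ suc) | B zero in B₀
... | inj₁ empty | false = inj₁ λ { zero → B₀ ; (suc x) → empty x }
... | inj₁ empty | true  =
  inj₂ (zero , B₀ , λ { zero _ → ≤-refl ; (suc x) Bx → ⊥-elim (true≢false (trans (sym Bx) (empty x))) })
... | inj₂ (b , Bb , max) | false =
  inj₂ (suc b , Bb , λ { zero B0 → ⊥-elim (true≢false (trans (sym B0) B₀)) ; (suc x) → max x })
... | inj₂ (b , Bb , max) | true with F zero ≤? F (suc b)
...   | yes F₀≤ = inj₂ (suc b , Bb , λ { zero _ → F₀≤ ; (suc x) → max x })
...   | no F₀≰  = inj₂ (zero , B₀ , λ { zero _ → ≤-refl ; (suc x) Bx → ≤-trans (max x Bx) (≰⇒≥ F₀≰) })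

above-average : ∀ {n} (B : VSet n) (F : Fin n → ℕ) → 0 < count B →
  Σ (Fin n) λ b → B b ≡ true × ∑[ x < n ] (⌜ B ⌝ x * F x) ≤ count B * F b
above-average B F ∣B∣>0 with heaviest B F
... | inj₁ empty = ⊥-elim (<⇒≢ ∣B∣>0 (sym (∑-zero (λ x → cong [_] (empty x)))))
... | inj₂ (b , Bb , max) = b , Bb , ≤-trans (∑-mono bounded) (≤-reflexive (sym (*-distribʳ-sum (F b) ⌜ B ⌝)))
  where
  bounded : ∀ x → ⌜ B ⌝ x * F x ≤ ⌜ B ⌝ x * F b
  bounded x with B x in Bx
  ... | true  = +-monoˡ-≤ 0 (max x Bx)
  ... | false = z≤n

-- The adjacency bilinear form  e(f,g) = ∑_{x ∼ y} f x · g y  on vertex weights.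
-- Edge counts between vertex sets are its values on indicator weights.
module EdgeSums {n : ℕ} (G : Graph n) where

  private
    regroup : ∀ a b c → a * (b * c) ≡ b * (a * c)
    regroup = solve-∀

  edge : (Fin n → ℕ) → (Fin n → ℕ) → Fin n → Fin n → ℕ
  edge f g x y = f x * (g y * [ adj G x y ])

  edgeSum : (Fin n → ℕ) → (Fin n → ℕ) → ℕ
  edgeSum f g = ∑[ x < n ] sum (edge f g x)

  nbr : (Fin n → ℕ) → Fin n → ℕ
  nbr f y = ∑[ x < n ] (f x * [ adj G x y ])

  cut : VSet n → ℕ
  cut X = edgeSum ⌜ X ⌝ ⌜ X ᶜ ⌝

  E-tabulate : ∀ s → E[ tabulate s , ∁ (tabulate s) ] G ≡ cut s
  E-tabulate s = trans (Σᵥ≡∑ λ x → Σᵥ (pair x)) (sum-cong-≗ λ x → trans (Σᵥ≡∑ (pair x)) (sum-cong-≗ (term x)))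
    where
    pair : Fin n → Fin n → ℕ
    pair x y = [ lookup (tabulate s) x ∧ (lookup (∁ (tabulate s)) y ∧ adj G x y) ]
    term : ∀ x y → pair x y ≡ ⌜ s ⌝ x * (⌜ s ᶜ ⌝ y * [ adj G x y ])
    term x y rewrite lookup-map y not (tabulate s) | lookup∘tabulate s x | lookup∘tabulate s y
      = trans ([∧] (s x) _) (cong (⌜ s ⌝ x *_) ([∧] (not (s y)) _))

  edgeSum-cong : ∀ {f f′ g g′} → (∀ x → f x ≡ f′ x) → (∀ y → g y ≡ g′ y) → edgeSum f g ≡ edgeSum f′ g′
  edgeSum-cong f≗ g≗ = sum-cong-≗ λ x → sum-cong-≗ λ y → cong₂ (λ a b → a * (b * _)) (f≗ x) (g≗ y)

  edgeSum-congʳ : ∀ f {g g′} → (∀ y → g y ≡ g′ y) → edgeSum f g ≡ edgeSum f g′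
  edgeSum-congʳ f = edgeSum-cong {f} (λ _ → refl)

  edgeSum-+ʳ : ∀ f g h → edgeSum f (λ y → g y + h y) ≡ edgeSum f g + edgeSum f h
  edgeSum-+ʳ f g h =
    trans (sum-cong-≗ λ x → trans (sum-cong-≗ λ y → split (f x) (g y) (h y) _) (∑-distrib-+ (edge f g x) (edge f h x)))
          (∑-distrib-+ (λ x → sum (edge f g x)) (λ x → sum (edge f h x)))
    where
    split : ∀ a b c d → a * ((b + c) * d) ≡ a * (b * d) + a * (c * d)
    split = solve-∀

  edgeSum-sym : ∀ f g → edgeSum f g ≡ edgeSum g f
  edgeSum-sym f g = trans (∑-comm (edge f g)) (sum-cong-≗ λ y → sum-cong-≗ λ x →
    trans (regroup (f x) (g y) _) (cong (λ a → g y * (f x * [ a ])) (Graph.sym G x y)))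

  edgeSum-+ˡ : ∀ f g h → edgeSum (λ x → f x + g x) h ≡ edgeSum f h + edgeSum g h
  edgeSum-+ˡ f g h = begin
    edgeSum (λ x → f x + g x) h  ≡⟨ edgeSum-sym (λ x → f x + g x) h ⟩
    edgeSum h (λ x → f x + g x)  ≡⟨ edgeSum-+ʳ h f g ⟩
    edgeSum h f + edgeSum h g    ≡⟨ cong₂ _+_ (edgeSum-sym h f) (edgeSum-sym h g) ⟩
    edgeSum f h + edgeSum g h    ∎
    where open ≡-Reasoning

  edgeSum-by-nbr : ∀ f g → edgeSum f g ≡ ∑[ y < n ] (g y * nbr f y)
  edgeSum-by-nbr f g = trans (∑-comm (edge f g)) (sum-cong-≗ λ y →
    trans (sum-cong-≗ λ x → regroup (f x) (g y) _) (sym (*-distribˡ-sum (g y) (λ x → f x * [ adj G x y ]))))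

  edgeSum-⁅⁆ : ∀ f b → edgeSum f ⌜ ⁅ b ⁆ ⌝ ≡ nbr f b
  edgeSum-⁅⁆ f b = trans (edgeSum-by-nbr f ⌜ ⁅ b ⁆ ⌝) (∑-δ b (nbr f))

module RegularGraph {n : ℕ} (G : Graph n) {k : ℕ} (reg : Regular k G) where
  open EdgeSums G

  edgeSum-all : ∀ f → edgeSum f (λ _ → 1) ≡ k * sum f
  edgeSum-all f = begin
    ∑[ x < n ] sum (edge f (λ _ → 1) x)  ≡⟨ sum-cong-≗ row ⟩
    ∑[ x < n ] (f x * k)                 ≡⟨ *-distribʳ-sum k f ⟨
    sum f * k                            ≡⟨ *-comm (sum f) k ⟩
    k * sum f                            ∎
    where
    open ≡-Reasoning
    row : ∀ x → sum (edge f (λ _ → 1) x) ≡ f x * k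
    row x = begin
      ∑[ y < n ] (f x * (1 * [ adj G x y ]))  ≡⟨ *-distribˡ-sum (f x) (λ y → 1 * [ adj G x y ]) ⟨
      f x * ∑[ y < n ] (1 * [ adj G x y ])    ≡⟨ cong (f x *_) (sum-cong-≗ λ y → *-identityˡ [ adj G x y ]) ⟩
      f x * ∑[ y < n ] [ adj G x y ]          ≡⟨ cong (f x *_) (trans (sym (Σᵥ≡∑ (λ y → [ adj G x y ]))) (reg x)) ⟩
      f x * k                                 ∎

  vol-regular : ∀ S → vol G S ≡ k * ∣ S ∣
  vol-regular S = begin
    vol G S                            ≡⟨ Σᵥ≡∑ (λ x → if lookup S x then deg G x else 0) ⟩
    sum (λ x → if lookup S x then deg G x else 0)  ≡⟨ sum-cong-≗ degree ⟩
    ∑[ x < n ] (k * ⌜ lookup S ⌝ x)    ≡⟨ *-distribˡ-sum k ⌜ lookup S ⌝ ⟨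
    k * count (lookup S)               ≡⟨ cong (k *_) (∣∣≡count S) ⟨
    k * ∣ S ∣                          ∎
    where
    open ≡-Reasoning
    degree : ∀ x → (if lookup S x then deg G x else 0) ≡ k * ⌜ lookup S ⌝ x
    degree x with lookup S x
    ... | true  = trans (reg x) (sym (*-identityʳ k))
    ... | false = sym (*-zeroʳ k)

  -- The k |X| edge ends at vertices of X either leave X or stay inside it.
  cut+inner : ∀ X → cut X + edgeSum ⌜ X ⌝ ⌜ X ⌝ ≡ k * count X
  cut+inner X = begin
    cut X + edgeSum ⌜ X ⌝ ⌜ X ⌝                           ≡⟨ edgeSum-+ʳ ⌜ X ⌝ ⌜ X ᶜ ⌝ ⌜ X ⌝ ⟨
    edgeSum ⌜ X ⌝ (λ y → ⌜ X ᶜ ⌝ y + ⌜ X ⌝ y)            ≡⟨ edgeSum-congʳ ⌜ X ⌝ (λ y → [not]+[] (X y)) ⟩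
    edgeSum ⌜ X ⌝ (λ _ → 1)                              ≡⟨ edgeSum-all ⌜ X ⌝ ⟩
    k * count X                                           ∎
    where open ≡-Reasoning

module BipartiteGraph {n : ℕ} (G : Graph n) {k : ℕ} (reg : Regular k G)
                      (c : Fin n → Bool) (proper : ∀ x y → x ∼[ G ] y → c x ≢ c y) where
  open EdgeSums G
  open RegularGraph G reg

  Class : Bool → VSet n
  Class true  = c
  Class false = c ᶜ

  class-colour : ∀ b x → Class b x ≡ true → c x ≡ b
  class-colour true  x cx = cx
  class-colour false x cx with c x
  ... | false = refl

  classes-disjoint : ∀ {X Y} → X ⊆ Class false → Y ⊆ Class true → Disjoint X Y
  classes-disjoint X⊆ Y⊆ x Xx Yx = true≢false (trans (sym (class-colour true x (Y⊆ x Yx))) (class-colour false x (X⊆ x Xx)))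

  ⌜classes⌝ : ∀ b y → ⌜ Class (not b) ⌝ y + ⌜ Class b ⌝ y ≡ 1
  ⌜classes⌝ true  y = [not]+[] (c y)
  ⌜classes⌝ false y = trans (+-comm [ c y ] _) ([not]+[] (c y))

  no-edges-within : ∀ {b X Y} → X ⊆ Class b → Y ⊆ Class b → edgeSum ⌜ X ⌝ ⌜ Y ⌝ ≡ 0
  no-edges-within {b} {X} {Y} X⊆ Y⊆ = ∑-zero {n} λ x → ∑-zero {n} λ y → no-edge x y
    where
    no-edge : ∀ x y → edge ⌜ X ⌝ ⌜ Y ⌝ x y ≡ 0
    no-edge x y with X x in Xx | Y y in Yy | adj G x y in x∼y
    ... | true  | true  | true  = ⊥-elim (proper x y x∼y
                                    (trans (class-colour b x (X⊆ x Xx)) (sym (class-colour b y (Y⊆ y Yy)))))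
    ... | true  | true  | false = refl
    ... | true  | false | _     = refl
    ... | false | _     | _     = refl

  -- Every edge at a vertex of one class ends in the other class.
  edges-across : ∀ {b X} → X ⊆ Class b → edgeSum ⌜ X ⌝ ⌜ Class (not b) ⌝ ≡ k * count X
  edges-across {b} {X} X⊆ = begin
    edgeSum ⌜ X ⌝ ⌜ Class (not b) ⌝                              ≡⟨ +-identityʳ _ ⟨
    edgeSum ⌜ X ⌝ ⌜ Class (not b) ⌝ + 0                          ≡⟨ cong (edgeSum ⌜ X ⌝ ⌜ Class (not b) ⌝ +_) (no-edges-within {b} X⊆ (λ _ e → e)) ⟨
    edgeSum ⌜ X ⌝ ⌜ Class (not b) ⌝ + edgeSum ⌜ X ⌝ ⌜ Class b ⌝  ≡⟨ edgeSum-+ʳ ⌜ X ⌝ ⌜ Class (not b) ⌝ ⌜ Class b ⌝ ⟨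
    edgeSum ⌜ X ⌝ (λ y → ⌜ Class (not b) ⌝ y + ⌜ Class b ⌝ y)    ≡⟨ edgeSum-congʳ ⌜ X ⌝ (⌜classes⌝ b) ⟩
    edgeSum ⌜ X ⌝ (λ _ → 1)                                      ≡⟨ edgeSum-all ⌜ X ⌝ ⟩
    k * count X                                                  ∎
    where open ≡-Reasoning

  -- Double counting the edges between the classes: both have the same size.
  class-sizes : .{{_ : NonZero k}} → count (Class false) ≡ count (Class true)
  class-sizes = *-cancelˡ-≡ _ _ k (begin
    k * count (Class false)                    ≡⟨ edges-across {false} {Class false} (λ _ e → e) ⟨
    edgeSum ⌜ Class false ⌝ ⌜ Class true ⌝     ≡⟨ edgeSum-sym ⌜ Class false ⌝ ⌜ Class true ⌝ ⟩
    edgeSum ⌜ Class true ⌝ ⌜ Class false ⌝     ≡⟨ edges-across {true} (λ _ e → e) ⟩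
    k * count (Class true)                     ∎)
    where open ≡-Reasoning

  class-sizes-sum : count (Class false) + count (Class true) ≡ n
  class-sizes-sum = trans (sym (∑-distrib-+ ⌜ Class false ⌝ ⌜ Class true ⌝))
                          (trans (sum-cong-≗ (⌜classes⌝ true)) (∑-one n))

  class-size : .{{_ : NonZero k}} → ∀ r → n ≡ 2 * r → count (Class true) ≡ r
  class-size r n≡2r = *-cancelˡ-≡ _ r 2 (begin
    2 * b                            ≡⟨ cong (b +_) (+-identityʳ b) ⟩
    b + b                            ≡⟨ cong (_+ b) class-sizes ⟨
    count (Class false) + b          ≡⟨ class-sizes-sum ⟩
    n                                ≡⟨ n≡2r ⟩
    2 * r                            ∎)
    where
    open ≡-Reasoning
    b : ℕ
    b = count (Class true)

  -- For P, T in opposite classes, the edges inside P ∪ T all run between P and T,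
  -- so  cut(P ∪ T) + 2 e(P,T) = k (|P| + |T|).
  cut-two-sided : ∀ {P T} → P ⊆ Class false → T ⊆ Class true →
    cut (P ∪ T) + 2 * edgeSum ⌜ P ⌝ ⌜ T ⌝ ≡ k * (count P + count T)
  cut-two-sided {P} {T} P⊆ T⊆ = begin
    cut (P ∪ T) + 2 * e[P,T]                     ≡⟨ cong (cut (P ∪ T) +_) inner ⟨
    cut (P ∪ T) + edgeSum ⌜ P ∪ T ⌝ ⌜ P ∪ T ⌝    ≡⟨ cut+inner (P ∪ T) ⟩
    k * count (P ∪ T)                            ≡⟨ cong (k *_) (count-∪ disjoint) ⟩
    k * (count P + count T)                      ∎
    where
    open ≡-Reasoning
    e[P,T] : ℕ
    e[P,T] = edgeSum ⌜ P ⌝ ⌜ T ⌝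
    disjoint : Disjoint P T
    disjoint = classes-disjoint P⊆ T⊆
    inner : edgeSum ⌜ P ∪ T ⌝ ⌜ P ∪ T ⌝ ≡ 2 * e[P,T]
    inner = begin
      edgeSum ⌜ P ∪ T ⌝ ⌜ P ∪ T ⌝                            ≡⟨ edgeSum-cong (⌜∪⌝ disjoint) (⌜∪⌝ disjoint) ⟩
      edgeSum (λ x → ⌜ P ⌝ x + ⌜ T ⌝ x) (λ y → ⌜ P ⌝ y + ⌜ T ⌝ y)
        ≡⟨ edgeSum-+ˡ ⌜ P ⌝ ⌜ T ⌝ (λ y → ⌜ P ⌝ y + ⌜ T ⌝ y) ⟩
      edgeSum ⌜ P ⌝ (λ y → ⌜ P ⌝ y + ⌜ T ⌝ y) + edgeSum ⌜ T ⌝ (λ y → ⌜ P ⌝ y + ⌜ T ⌝ y)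
        ≡⟨ cong₂ _+_ (edgeSum-+ʳ ⌜ P ⌝ ⌜ P ⌝ ⌜ T ⌝) (edgeSum-+ʳ ⌜ T ⌝ ⌜ P ⌝ ⌜ T ⌝) ⟩
      (edgeSum ⌜ P ⌝ ⌜ P ⌝ + e[P,T]) + (edgeSum ⌜ T ⌝ ⌜ P ⌝ + edgeSum ⌜ T ⌝ ⌜ T ⌝)
        ≡⟨ cong₂ _+_ (cong (_+ e[P,T]) (no-edges-within {false} P⊆ P⊆))
                     (cong₂ _+_ (edgeSum-sym ⌜ T ⌝ ⌜ P ⌝) (no-edges-within {true} T⊆ T⊆)) ⟩
      e[P,T] + (e[P,T] + 0)                                  ≡⟨⟩
      2 * e[P,T]                                             ∎

  two-cuts : ∀ {P T₁ T₂ E} → P ⊆ Class false → T₁ ⊆ Class true → T₂ ⊆ Class true →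
    (∀ y → ⌜ T₁ ⌝ y + ⌜ T₂ ⌝ y ≡ ⌜ Class true ⌝ y + ⌜ E ⌝ y) →
    cut (P ∪ T₁) + cut (P ∪ T₂) + 2 * edgeSum ⌜ P ⌝ ⌜ E ⌝ ≡ k * count (Class true) + k * count E
  two-cuts {P} {T₁} {T₂} {E} P⊆ T₁⊆ T₂⊆ cover = +-cancelʳ-≡ (2 * (k * p)) _ _ (begin
    a₁ + a₂ + 2 * e + 2 * (k * p)          ≡⟨ regroup₁ a₁ a₂ e (k * p) ⟩
    a₁ + a₂ + 2 * (k * p + e)              ≡⟨ cong (λ z → a₁ + a₂ + 2 * z) across ⟨
    a₁ + a₂ + 2 * (t₁ + t₂)                ≡⟨ regroup₂ a₁ a₂ t₁ t₂ ⟩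
    (a₁ + 2 * t₁) + (a₂ + 2 * t₂)          ≡⟨ cong₂ _+_ (cut-two-sided P⊆ T₁⊆) (cut-two-sided P⊆ T₂⊆) ⟩
    k * (p + u₁) + k * (p + u₂)            ≡⟨ regroup₃ k p u₁ u₂ ⟩
    k * (u₁ + u₂) + 2 * (k * p)            ≡⟨ cong (λ z → k * z + 2 * (k * p)) sizes ⟩
    k * (b + ε) + 2 * (k * p)              ≡⟨ cong (_+ 2 * (k * p)) (*-distribˡ-+ k b ε) ⟩
    k * b + k * ε + 2 * (k * p)            ∎)
    where
    open ≡-Reasoning
    a₁ a₂ t₁ t₂ e p u₁ u₂ b ε : ℕ
    a₁ = cut (P ∪ T₁)
    a₂ = cut (P ∪ T₂)
    t₁ = edgeSum ⌜ P ⌝ ⌜ T₁ ⌝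
    t₂ = edgeSum ⌜ P ⌝ ⌜ T₂ ⌝
    e = edgeSum ⌜ P ⌝ ⌜ E ⌝
    p = count P
    u₁ = count T₁
    u₂ = count T₂
    b = count (Class true)
    ε = count E
    across : t₁ + t₂ ≡ k * p + e
    across = begin
      t₁ + t₂                                             ≡⟨ edgeSum-+ʳ ⌜ P ⌝ ⌜ T₁ ⌝ ⌜ T₂ ⌝ ⟨
      edgeSum ⌜ P ⌝ (λ y → ⌜ T₁ ⌝ y + ⌜ T₂ ⌝ y)           ≡⟨ edgeSum-congʳ ⌜ P ⌝ cover ⟩
      edgeSum ⌜ P ⌝ (λ y → ⌜ Class true ⌝ y + ⌜ E ⌝ y)    ≡⟨ edgeSum-+ʳ ⌜ P ⌝ ⌜ Class true ⌝ ⌜ E ⌝ ⟩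
      edgeSum ⌜ P ⌝ ⌜ Class true ⌝ + e                    ≡⟨ cong (_+ e) (edges-across P⊆) ⟩
      k * p + e                                           ∎
    sizes : u₁ + u₂ ≡ b + ε
    sizes = trans (sym (∑-distrib-+ ⌜ T₁ ⌝ ⌜ T₂ ⌝)) (trans (sum-cong-≗ cover) (∑-distrib-+ ⌜ Class true ⌝ ⌜ E ⌝))
    regroup₁ : ∀ a₁ a₂ e q → a₁ + a₂ + 2 * e + 2 * q ≡ a₁ + a₂ + 2 * (q + e)
    regroup₁ = solve-∀
    regroup₂ : ∀ a₁ a₂ t₁ t₂ → a₁ + a₂ + 2 * (t₁ + t₂) ≡ (a₁ + 2 * t₁) + (a₂ + 2 * t₂)
    regroup₂ = solve-∀
    regroup₃ : ∀ k p u₁ u₂ → k * (p + u₁) + k * (p + u₂) ≡ k * (u₁ + u₂) + 2 * (k * p)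
    regroup₃ = solve-∀

  balanced-cut : ∀ {m P E Q} → P ⊆ Class false → E ⊆ Class true → Q ⊆ Class true ∖ E →
    count P ≡ m → count Q ≡ m → count (Class true) ≡ m + m + count E →
    Σ (VSet n) λ S → count S ≡ count (Class true) ×
                     2 * cut S + 2 * edgeSum ⌜ P ⌝ ⌜ E ⌝ ≤ k * count (Class true) + k * count E
  balanced-cut {m} {P} {E} {Q} P⊆ E⊆ Q⊆ ∣P∣ ∣Q∣ ∣B∣ =
    let S , ∣S∣ , 2cut≤ = smaller-of-two cut {λ S → count S ≡ count (Class true)} ∣S₁∣ ∣S₂∣
    in  S , ∣S∣ , ≤-trans (+-monoˡ-≤ (2 * edgeSum ⌜ P ⌝ ⌜ E ⌝) 2cut≤)
                          (≤-reflexive (two-cuts {P} {T₁} {T₂} P⊆ T₁⊆ (∖⊆ {X = Class true} {Y = Q}) (⌜cover⌝ Q⊆)))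
    where
    T₁ T₂ : VSet n
    T₁ = Q ∪ E
    T₂ = Class true ∖ Q
    ε : ℕ
    ε = count E
    ∣T₁∣ : count T₁ ≡ m + ε
    ∣T₁∣ = trans (count-∪ {X = Q} {Y = E} (λ x Qx → ∖-disjoint {X = Class true} {Y = E} x (Q⊆ x Qx))) (cong (_+ ε) ∣Q∣)
    ∣T₂∣ : count T₂ ≡ m + ε
    ∣T₂∣ = +-cancelˡ-≡ (m + ε) _ _ (begin
      (m + ε) + count T₂          ≡⟨ cong (_+ count T₂) ∣T₁∣ ⟨
      count T₁ + count T₂         ≡⟨ ∑-distrib-+ ⌜ T₁ ⌝ ⌜ T₂ ⌝ ⟨
      sum (λ y → ⌜ T₁ ⌝ y + ⌜ T₂ ⌝ y)  ≡⟨ sum-cong-≗ (⌜cover⌝ Q⊆) ⟩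
      sum (λ y → ⌜ Class true ⌝ y + ⌜ E ⌝ y)  ≡⟨ ∑-distrib-+ ⌜ Class true ⌝ ⌜ E ⌝ ⟩
      count (Class true) + ε      ≡⟨ cong (_+ ε) ∣B∣ ⟩
      m + m + ε + ε               ≡⟨ regroup m ε ⟩
      (m + ε) + (m + ε)           ∎)
      where
      open ≡-Reasoning
      regroup : ∀ m ε → m + m + ε + ε ≡ (m + ε) + (m + ε)
      regroup = solve-∀
    ∣P∪T∣ : ∀ {T} → T ⊆ Class true → count T ≡ m + ε → count (P ∪ T) ≡ count (Class true)
    ∣P∪T∣ T⊆ ∣T∣ = trans (count-∪ (classes-disjoint P⊆ T⊆))
                         (trans (cong₂ _+_ ∣P∣ ∣T∣) (trans (sym (+-assoc m m ε)) (sym ∣B∣)))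
    T₁⊆ : T₁ ⊆ Class true
    T₁⊆ = ∪⊆ {X = Q} (λ x Qx → ∖⊆ {X = Class true} {Y = E} x (Q⊆ x Qx)) E⊆
    ∣S₁∣ : count (P ∪ T₁) ≡ count (Class true)
    ∣S₁∣ = ∣P∪T∣ T₁⊆ ∣T₁∣
    ∣S₂∣ : count (P ∪ T₂) ≡ count (Class true)
    ∣S₂∣ = ∣P∪T∣ (∖⊆ {X = Class true} {Y = Q}) ∣T₂∣

  heavy-vertex : ∀ {P} → P ⊆ Class false → 0 < count (Class true) →
    Σ (Fin n) λ b₀ → c b₀ ≡ true × k * count P ≤ count (Class true) * edgeSum ⌜ P ⌝ ⌜ ⁅ b₀ ⁆ ⌝
  heavy-vertex {P} P⊆ ∣B∣>0 =
    let b₀ , b₀∈B , average≤ = above-average (Class true) (nbr ⌜ P ⌝) ∣B∣>0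
    in  b₀ , b₀∈B , (begin
      k * count P                                  ≡⟨ edges-across P⊆ ⟨
      edgeSum ⌜ P ⌝ ⌜ Class true ⌝                  ≡⟨ edgeSum-by-nbr ⌜ P ⌝ ⌜ Class true ⌝ ⟩
      ∑[ y < n ] (⌜ Class true ⌝ y * nbr ⌜ P ⌝ y)  ≤⟨ average≤ ⟩
      count (Class true) * nbr ⌜ P ⌝ b₀             ≡⟨ cong (count (Class true) *_) (edgeSum-⁅⁆ ⌜ P ⌝ b₀) ⟨
      count (Class true) * edgeSum ⌜ P ⌝ ⌜ ⁅ b₀ ⁆ ⌝ ∎)
    where open ≤-Reasoning

  -- The two constructions are opaque: only their stated properties are used,
  -- and unfolding them during type checking would be very expensive.
  opaque
    -- r = 2m: take |P| = |Q| = m and E = ∅; some S has |S| = r and 2 cut(S) ≤ k r.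
    even-cut : ∀ m → count (Class false) ≡ 2 * m → count (Class true) ≡ 2 * m →
      Σ (VSet n) λ S → count S ≡ 2 * m × 2 * cut S ≤ k * (2 * m)
    even-cut m ∣A∣ ∣B∣ =
      let P , P⊆ , ∣P∣    = select (Class false) m (≤-trans (m≤m+n m _) (≤-reflexive (sym ∣A∣)))
          Q , Q⊆ , ∣Q∣    = select (Class true) m (≤-trans (m≤m+n m _) (≤-reflexive (sym ∣B∣)))
          S , ∣S∣ , bound = balanced-cut {m} {P} {∅} {Q} P⊆ (λ _ ()) (λ x Qx → trans (∧-identityʳ _) (Q⊆ x Qx))
                              ∣P∣ ∣Q∣ (trans ∣B∣ (sym (trans (cong (m + m +_) (count-∅ {n})) (+-assoc m m 0))))
      in  S , trans ∣S∣ ∣B∣ , (begin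
        2 * cut S                                                  ≤⟨ m≤m+n _ _ ⟩
        2 * cut S + 2 * edgeSum ⌜ P ⌝ ⌜ ∅ ⌝                        ≤⟨ bound ⟩
        k * count (Class true) + k * count {n} ∅                  ≡⟨ cong₂ (λ b e → k * b + k * e) ∣B∣ (count-∅ {n}) ⟩
        k * (2 * m) + k * 0                                        ≡⟨ cong (k * (2 * m) +_) (*-zeroʳ k) ⟩
        k * (2 * m) + 0                                            ≡⟨ +-identityʳ _ ⟩
        k * (2 * m)                                                ∎)
      where open ≤-Reasoning

    -- r = 2m + 1: take |P| = m, a heavy vertex b₀ for P, E = {b₀} and |Q| = m;
    -- some S has |S| = r and r · 2 cut(S) ≤ k (r² + 1).
    odd-cut : ∀ m → count (Class false) ≡ suc (2 * m) → count (Class true) ≡ suc (2 * m) →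
      Σ (VSet n) λ S → count S ≡ suc (2 * m) × suc (2 * m) * (2 * cut S) ≤ k * (suc (2 * m) * suc (2 * m) + 1)
    odd-cut m ∣A∣ ∣B∣ =
      let P , P⊆ , ∣P∣         = select (Class false) m (≤-trans (m≤m+n m _) (≤-trans (n≤1+n _) (≤-reflexive (sym ∣A∣))))
          b₀ , b₀∈B , heavy    = heavy-vertex P⊆ (subst (0 <_) (sym ∣B∣) (s≤s z≤n))
          Q , Q⊆ , ∣Q∣         = select (Class true ∖ ⁅ b₀ ⁆) m (≤-trans (m≤m+n m _) (≤-reflexive (sym (∣B∖b₀∣ b₀∈B))))
          S , ∣S∣ , bound      = balanced-cut P⊆ (⁅⁆⊆ b₀∈B) Q⊆ ∣P∣ ∣Q∣ (trans ∣B∣ (∣B∣-split (count-⁅⁆ b₀)))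
          d                    = edgeSum ⌜ P ⌝ ⌜ ⁅ b₀ ⁆ ⌝
      in  S , trans ∣S∣ ∣B∣ , odd-bound m k (cut S) d
            (subst₂ (λ b e → 2 * cut S + 2 * d ≤ k * b + k * e) ∣B∣ (count-⁅⁆ b₀) bound)
            (subst₂ (λ p b → k * p ≤ b * d) ∣P∣ ∣B∣ heavy)
      where
      ∣B∖b₀∣ : ∀ {b₀} → c b₀ ≡ true → count (Class true ∖ ⁅ b₀ ⁆) ≡ 2 * m
      ∣B∖b₀∣ {b₀} b₀∈B = +-cancelʳ-≡ 1 _ _ (begin
        count (Class true ∖ ⁅ b₀ ⁆) + 1               ≡⟨ cong (count (Class true ∖ ⁅ b₀ ⁆) +_) (count-⁅⁆ b₀) ⟨
        count (Class true ∖ ⁅ b₀ ⁆) + count ⁅ b₀ ⁆    ≡⟨ count-∖ {X = Class true} (⁅⁆⊆ b₀∈B) ⟩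
        count (Class true)                            ≡⟨ ∣B∣ ⟩
        suc (2 * m)                                   ≡⟨ +-comm 1 (2 * m) ⟩
        2 * m + 1                                     ∎)
        where open ≡-Reasoning
      ∣B∣-split : ∀ {e} → e ≡ 1 → suc (2 * m) ≡ m + m + e
      ∣B∣-split refl = trans (+-comm 1 (2 * m)) (cong (λ z → m + z + 1) (+-identityʳ m))

-- The Cheeger constant is the minimum of a list of ratios.  When every
-- nonempty set has positive volume all entries are defined, and every
-- admissible set bounds the minimum from above.

IsDefined : Maybe ℚ → Set
IsDefined q = Σ ℚ λ p → q ≡ just p

LowerBound : ℚ → Maybe ℚ → Set
LowerBound h q = ∀ p → q ≡ just p → h ≤ℚ p

minimum-lower-bound : ∀ q qs → All IsDefined (q ∷ qs) →
  Σ ℚ λ h → minimum (q ∷ qs) ≡ just h × All (LowerBound h) (q ∷ qs)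
minimum-lower-bound nothing qs ((_ , ()) ∷ _)
minimum-lower-bound (just p) [] _ = p , refl , (λ { _ refl → ℚ.≤-refl }) ∷ []
minimum-lower-bound (just p) (q ∷ qs) (_ ∷ defined) with minimum-lower-bound q qs defined
... | h , min≡h , below rewrite min≡h =
  p ⊓ h , refl , (λ { _ refl → ℚ.p⊓q≤p p h }) ∷ All.map (λ h≤ p′ eq → ℚ.≤-trans (ℚ.p⊓q≤q p h) (h≤ p′ eq)) below

allSubsets-complete : ∀ {n} (S : Subset n) → S ∈ allSubsets n
allSubsets-complete Vec.[] = here refl
allSubsets-complete {suc n} (true ∷ S) = ∈-++⁺ˡ (∈-map⁺ (true ∷_) (allSubsets-complete S))
allSubsets-complete {suc n} (false ∷ S) =
  ∈-++⁺ʳ (List.map (true ∷_) (allSubsets n)) (∈-map⁺ (false ∷_) (allSubsets-complete S))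

module CheegerBound {n : ℕ} (G : Graph n)
                    (vol-pos : ∀ (S : Subset n) s → ∣ S ∣ ≡ suc s → vol G S ≢ 0) where

  ratios-defined : ∀ Ss → All IsDefined (ratios G Ss)
  ratios-defined [] = []
  ratios-defined (S ∷ Ss) with ∣ S ∣ in ∣S∣ | 2 * ∣ S ∣ ≤ᵇ n | vol G S in volS
  ... | zero  | _     | _     = ratios-defined Ss
  ... | suc _ | false | _     = ratios-defined Ss
  ... | suc s | true  | zero  = ⊥-elim (vol-pos S s ∣S∣ volS)
  ... | suc _ | true  | suc _ = (_ , refl) ∷ ratios-defined Ss

  ratio-∈ : ∀ {Ss S s v} → S ∈ Ss → ∣ S ∣ ≡ suc s → (2 * ∣ S ∣ ≤ᵇ n) ≡ true → vol G S ≡ suc v →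
    just ((ℤ.+ E[ S , ∁ S ] G) / suc v) ∈ ratios G Ss
  ratio-∈ {S ∷ _} {S} (here refl) ∣S∣ small volS with ∣ S ∣ | 2 * ∣ S ∣ ≤ᵇ n | vol G S
  ... | suc _ | true | suc _ with refl ← volS = here refl
  ratio-∈ {S′ ∷ Ss} (there S∈) ∣S∣ small volS with ∣ S′ ∣ | 2 * ∣ S′ ∣ ≤ᵇ n | vol G S′
  ... | zero  | _     | _     = ratio-∈ {Ss} S∈ ∣S∣ small volS
  ... | suc _ | false | _     = ratio-∈ {Ss} S∈ ∣S∣ small volS
  ... | suc _ | true  | zero  = there (ratio-∈ {Ss} S∈ ∣S∣ small volS)
  ... | suc _ | true  | suc _ = there (ratio-∈ {Ss} S∈ ∣S∣ small volS)

  cheeger-≤ : ∀ S s v → ∣ S ∣ ≡ suc s → 2 * ∣ S ∣ ≤ n → vol G S ≡ suc v →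
    Σ ℚ λ h → cheeger G ≡ just h × h ≤ℚ (ℤ.+ E[ S , ∁ S ] G) / suc v
  cheeger-≤ S s v ∣S∣ small volS
    with ratios G (allSubsets n) | ratio-∈ (allSubsets-complete S) ∣S∣ (Equivalence.to T-≡ (≤⇒≤ᵇ small)) volS
       | ratios-defined (allSubsets n)
  ... | q ∷ qs | S∈ | defined =
    let h , min≡h , below = minimum-lower-bound q qs defined
    in  h , min≡h , All.lookup below S∈ _ refl

-- Comparing a fraction of naturals with a rational q, through an
-- unnormalised representative c/d of q, by cross-multiplication.
/-≤ : ∀ {q} a b c d → toℚᵘ q ≃ᵘ mkℚᵘ (ℤ.+ c) d → a * suc d ≤ c * suc b → (ℤ.+ a) / suc b ≤ℚ q
/-≤ {q} a b c d q≃c/d ad≤cb = ℚ.toℚᵘ-cancel-≤ (begin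
  toℚᵘ ((ℤ.+ a) / suc b)  ≃⟨ ℚ.toℚᵘ-fromℚᵘ (mkℚᵘ (ℤ.+ a) b) ⟩
  mkℚᵘ (ℤ.+ a) b          ≤⟨ ℚᵘ.*≤* cross ⟩
  mkℚᵘ (ℤ.+ c) d          ≃⟨ ℚᵘ.≃-sym q≃c/d ⟩
  toℚᵘ q                  ∎)
  where
  open ℚᵘ.≤-Reasoning
  cross : ℤ.+ a ℤ.* ℤ.+ suc d ℤ.≤ ℤ.+ c ℤ.* ℤ.+ suc b
  cross = subst₂ ℤ._≤_ (ℤ.pos-* a (suc d)) (ℤ.pos-* c (suc b)) (ℤ.+≤+ ad≤cb)

½+1/-representative : ∀ N .{{_ : NonZero N}} → toℚᵘ (½ +ℚ ℤ.+ 1 / N) ≃ᵘ mkℚᵘ (ℤ.+ (N + 2)) (ℕ.pred (2 * N))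
½+1/-representative (suc d) = ℚᵘ.≃-trans (ℚ.toℚᵘ-homo-+ ½ (ℤ.+ 1 / suc d))
  (ℚᵘ.≃-trans (ℚᵘ.+-congʳ (toℚᵘ ½) (ℚ.toℚᵘ-fromℚᵘ (mkℚᵘ (ℤ.+ 1) d))) (ℚᵘ.*≡* (cong ℤ.+_ numerators)))
  where
  -- the sum is (1·N + 1·2)/(2N); the numerator equals N + 2
  numerators : ((suc d + 0) + 2) * suc (d + (suc d + 0)) ≡ (suc d + 2) * suc (d + (suc d + 0))
  numerators = cong (λ N → (N + 2) * suc (d + (suc d + 0))) (+-identityʳ (suc d))


degree-pos : ∀ {n} (G : Graph n) {k} → Regular k G → Connected G → 2 ≤ n → 0 < k
degree-pos {suc (suc n)} G {k} reg conn (s≤s (s≤s z≤n)) with conn zero (suc zero)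
... | _◅_ {j = y} 0∼y _ = begin
  1                           ≡⟨ cong [_] 0∼y ⟨
  [ adj G zero y ]            ≤⟨ ∑-term (λ z → [ adj G zero z ]) y ⟩
  sum (λ z → [ adj G zero z ]) ≡⟨ trans (sym (Σᵥ≡∑ (λ z → [ adj G zero z ]))) (reg zero) ⟩
  k                           ∎
  where open ≤-Reasoning

module CheegerOfBipartite {r′ k′ : ℕ} (G : Graph (2 * suc r′)) (reg : Regular (suc k′) G)
                          (c : Fin (2 * suc r′) → Bool) (proper : ∀ x y → x ∼[ G ] y → c x ≢ c y) where
  open EdgeSums G
  open RegularGraph G reg
  open BipartiteGraph G reg c proper

  r k v : ℕ
  r = suc r′
  k = suc k′
  v = r′ + k′ * r  -- vol(S) = k r = suc v for |S| = r

  vol-pos : ∀ (S : Subset (2 * r)) s → ∣ S ∣ ≡ suc s → vol G S ≢ 0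
  vol-pos S s ∣S∣ vol≡0 with trans (sym vol≡0) (trans (vol-regular S) (cong (k *_) ∣S∣))
  ... | ()

  open CheegerBound G vol-pos

  ∣B∣ : count (Class true) ≡ r
  ∣B∣ = class-size r refl

  ∣A∣ : count (Class false) ≡ r
  ∣A∣ = trans class-sizes ∣B∣

  cheeger-≤-cut : ∀ S → count S ≡ r → Σ ℚ λ h → cheeger G ≡ just h × h ≤ℚ (ℤ.+ cut S) / suc v
  cheeger-≤-cut S ∣S∣ =
    let h , cheeger≡h , h≤ = cheeger-≤ (tabulate S) r′ v ∣S′∣ (≤-reflexive (cong (2 *_) ∣S′∣))
                                       (trans (vol-regular (tabulate S)) (cong (k *_) ∣S′∣))
    in  h , cheeger≡h , subst (λ e → h ≤ℚ (ℤ.+ e) / suc v) (E-tabulate S) h≤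
    where
    ∣S′∣ : ∣ tabulate S ∣ ≡ r
    ∣S′∣ = trans (∣∣≡count (tabulate S)) (trans (sum-cong-≗ λ x → cong [_] (lookup∘tabulate S x)) ∣S∣)

  even : ∀ m → r ≡ 2 * m → Σ ℚ λ h → cheeger G ≡ just h × h ≤ℚ ½
  even m r≡2m =
    let S , ∣S∣ , 2cut≤ = even-cut m (trans ∣A∣ r≡2m) (trans ∣B∣ r≡2m)
        h , cheeger≡h , h≤ = cheeger-≤-cut S (trans ∣S∣ (sym r≡2m))
    in  h , cheeger≡h , ℚ.≤-trans h≤ (/-≤ (cut S) v 1 1 ℚᵘ.≃-refl (begin
          cut S * 2      ≡⟨ *-comm (cut S) 2 ⟩
          2 * cut S      ≤⟨ 2cut≤ ⟩
          k * (2 * m)    ≡⟨ cong (k *_) r≡2m ⟨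
          k * r          ≡⟨ *-identityˡ (k * r) ⟨
          1 * suc v      ∎))
    where open ≤-Reasoning

  odd : ∀ m → r ≡ 2 * m + 1 →
    Σ ℚ λ h → cheeger G ≡ just h × h ≤ℚ ½ +ℚ (ℤ.+ 1 / (2 * suc (2 * m) * suc (2 * m)))
  odd m r≡2m+1 =
    let R≡ : r ≡ suc (2 * m)
        R≡ = trans r≡2m+1 (+-comm (2 * m) 1)
        S , ∣S∣ , R2cut≤ = odd-cut m (trans ∣A∣ R≡) (trans ∣B∣ R≡)
        h , cheeger≡h , h≤ = cheeger-≤-cut S (trans ∣S∣ (sym R≡))
    in  h , cheeger≡h , ℚ.≤-trans h≤ (/-≤ (cut S) v _ _ (½+1/-representative (2 * suc (2 * m) * suc (2 * m)))
          (subst (λ R → cut S * (2 * (2 * suc (2 * m) * suc (2 * m))) ≤ (2 * suc (2 * m) * suc (2 * m) + 2) * (k * R))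
                 (sym R≡) (odd-scale (suc (2 * m)) k (cut S) R2cut≤)))

-- The statement writes integers with the prefix +_, opened only here since
-- it clashes with _+_ in operator sections above.
open import Data.Integer using (+_)

-- Connectivity makes the degree positive; then both bounds are those of
-- CheegerOfBipartite.
lemma5p2 : (r k : ℕ) → 1 ≤ r → (G : Graph (2 * r)) →
    Connected G → Bipartite G → Regular k G →
    ((m : ℕ) → r ≡ 2 * m →
      Σ ℚ λ h → cheeger G ≡ just h × h ≤ℚ ½)
    × ((m : ℕ) → r ≡ 2 * m + 1 →
      Σ ℚ λ h → cheeger G ≡ just h × h ≤ℚ ½ +ℚ (+ 1 / (2 * suc (2 * m) * suc (2 * m))))
lemma5p2 (suc r′) k _ G connected (c , proper) reg
  with degree-pos G reg connected (*-monoʳ-≤ 2 (s≤s (z≤n {r′})))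
... | s≤s _ = CheegerOfBipartite.even G reg c proper , CheegerOfBipartite.odd G reg c proper
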